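{- Let $j,k$ be positive integers with $\mathbf{B}_j^k$ finite. If $\max(\mathbf{B}_j^k) < 2^k(j+1)$, then $\overline{\mathbf{B}_j^k} = \emptyset$.
   Context: For positive integers $j,k$, a positive integer $n$ is called $(j,k)$-representable if $n = x_1^k + \cdots + x_j^k$ with all $x_i$ positive integers. Let $\mathbf{B}_j^k$ denote the set of positive integers that are not $(j,k)$-representable, and put $S_j^k = \{ n - j : n \in \mathbf{B}_j^k,\ n > j\}$. Define $\mathbf{B}^k = \bigcap_{j \ge 1} S_j^k$ and $\overline{\mathbf{B}_j^k} = S_j^k \setminus \mathbf{B}^k$. -}

module Defs where

open import Data.Nat using (ℕ; _+_; _*_; _^_; _≤_; _<_)
open import Data.Vec using (Vec; map; sum)
open import Data.Vec.Relation.Unary.All using (All)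
open import Data.Product using (Σ; _×_; ∃)
open import Relation.Binary.PropositionalEquality using (_≡_)
open import Relation.Nullary using (¬_)

Representable : ℕ → ℕ → ℕ → Set
Representable j k n =
  Σ (Vec ℕ j) λ xs → All (λ x → 1 ≤ x) xs × sum (map (λ x → x ^ k) xs) ≡ n

B : ℕ → ℕ → ℕ → Set
B j k n = 1 ≤ n × ¬ Representable j k n

-- S_j^k = { n - j : n ∈ B_j^k, n > j }, i.e. m ∈ S_j^k iff m ≥ 1 and m + j ∈ B_j^k
S : ℕ → ℕ → ℕ → Set
S j k m = 1 ≤ m × B j k (m + j)

BInf : ℕ → ℕ → Set
BInf k m = ∀ j → 1 ≤ j → S j k m

Bbar : ℕ → ℕ → ℕ → Set
Bbar j k m = S j k m × ¬ BInf k m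

FiniteSet : (ℕ → Set) → Set
FiniteSet P = ∃ λ N → ∀ n → P n → n ≤ N

IsMax : (ℕ → Set) → ℕ → Set
IsMax P M = P M × (∀ n → P n → n ≤ M)

-- Subtracting 1 from each part, n = m + j is (j,k)-representable iff m is a sum of at most j
-- "excesses" y^k − 1 with y ≥ 2, each at least c = 2^k − 1.  If m lies in S_j^k but not in B^k,
-- then m is a sum of more than j excesses, so m ≥ (j+1)c, while m + j ≤ max B_j^k < 2^k(j+1)
-- forces m ≤ (j+1)c.  Hence m = (j+1)c, and it remains to see that (j+1)c is a sum of at most
-- j excesses whenever every larger number is.  For j ≥ 2^k use one 4 and j − 2^k twos; for
-- k = 1 only j = 1 remains, and 2 = 3 − 1.  For j < 2^k and k ≥ 2, the excesses (j+1)c + r with 1 ≤ r ≤ c − 1 cannot all be represented: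
-- a part ≥ 4 would already be too large, so such a representation uses δ threes and otherwise
-- twos, whence δ(3^k − 2^k) ≡ r (mod c) with 1 ≤ δ ≤ c − 2, and by pigeonhole two values of r
-- would share δ.
module Submission where

open import Defs
open import Data.Nat using (ℕ; zero; suc; _+_; _*_; _^_; _%_; _≤_; _<_; z≤n; s≤s; _≤?_; NonZero; >-nonZero)
open import Data.Nat.Properties
open import Data.Nat.DivMod using ([m+kn]%n≡m%n; m<n⇒m%n≡m)
open import Data.Nat.Tactic.RingSolver using (solve-∀)
open import Data.List using (List; []; _∷_; length; map; replicate)
open import Data.Nat.ListAction using (sum)
open import Data.List.Properties using (length-replicate)
open import Data.List.Relation.Unary.All as All using (All; []; _∷_)
open import Data.List.Relation.Unary.All.Properties using (replicate⁺)
open import Data.List.Relation.Unary.Any using (Any; here; there)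
open import Data.Vec as Vec using (Vec)
import Data.Vec.Relation.Unary.All as Vecᴬ
open import Data.Fin using (Fin; toℕ; fromℕ<) renaming (zero to fzero; suc to fsuc)
open import Data.Fin.Properties using (pigeonhole; toℕ≤pred[n]; toℕ-fromℕ<)
open import Data.Product using (Σ; _×_; _,_; proj₁; proj₂)
open import Data.Sum using (_⊎_; inj₁; inj₂)
open import Data.Empty using (⊥; ⊥-elim)
open import Function using (_∘_)
open import Relation.Nullary using (¬_; yes; no)
open import Relation.Binary.PropositionalEquality

powerSum : ℕ → List ℕ → ℕ
powerSum k ys = sum (map (_^ k) ys)

-- ys lists the parts ≥ 2 of a representation of m + j; the remaining j − length ys parts are 1.
ExcessRepresentable : ℕ → ℕ → ℕ → Set
ExcessRepresentable j k m =
  Σ (List ℕ) λ ys → All (2 ≤_) ys × length ys ≤ j × powerSum k ys ≡ m + length ys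

^-distribʳ-* : ∀ m n k → (m * n) ^ k ≡ m ^ k * n ^ k
^-distribʳ-* m n zero = refl
^-distribʳ-* m n (suc k) = trans (cong (m * n *_) (^-distribʳ-* m n k)) (swap m n (m ^ k) (n ^ k))
  where
  swap : ∀ a b x y → a * b * (x * y) ≡ a * x * (b * y)
  swap = solve-∀

2^k+5≤3^k : ∀ {k} → 2 ≤ k → 2 ^ k + 5 ≤ 3 ^ k
2^k+5≤3^k {suc zero} (s≤s ())
2^k+5≤3^k {suc (suc zero)} _ = ≤-refl
2^k+5≤3^k {suc (suc (suc k))} _ = begin
  2 * a + 5            ≤⟨ m≤m+n (2 * a + 5) (a + 10) ⟩
  2 * a + 5 + (a + 10) ≡⟨ triple a ⟩
  3 * (a + 5)          ≤⟨ *-monoʳ-≤ 3 (2^k+5≤3^k {suc (suc k)} (s≤s (s≤s z≤n))) ⟩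
  3 * 3 ^ suc (suc k)  ∎
  where
  open ≤-Reasoning
  a = 2 ^ suc (suc k)
  triple : ∀ x → 2 * x + 5 + (x + 10) ≡ 3 * (x + 5)
  triple = solve-∀

¬¬-∀-Fin : ∀ {n} {P : Fin n → Set} → (∀ i → ¬ ¬ P i) → ¬ ¬ (∀ i → P i)
¬¬-∀-Fin {zero} _ ¬all = ¬all λ ()
¬¬-∀-Fin {suc n} ¬¬P ¬all =
  ¬¬P fzero λ p₀ → ¬¬-∀-Fin (¬¬P ∘ fsuc) λ ps → ¬all λ { fzero → p₀ ; (fsuc i) → ps i }

remainder-unique : ∀ {c} .{{_ : NonZero c}} q r p t → q * c + r ≡ p * c + t → t < c → r % c ≡ t
remainder-unique {c} q r p t eq t<c = begin
  r % c           ≡⟨ sym ([m+kn]%n≡m%n r q c) ⟩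
  (r + q * c) % c ≡⟨ cong (_% c) (trans (+-comm r (q * c)) (trans eq (+-comm (p * c) t))) ⟩
  (t + p * c) % c ≡⟨ [m+kn]%n≡m%n t p c ⟩
  t % c           ≡⟨ m<n⇒m%n≡m t<c ⟩
  t               ∎
  where open ≡-Reasoning

parts-above-one : ∀ {j} k (xs : Vec ℕ j) → Vecᴬ.All (1 ≤_) xs →
  Σ (List ℕ) λ ys → All (2 ≤_) ys × length ys ≤ j ×
    powerSum k ys + j ≡ Vec.sum (Vec.map (_^ k) xs) + length ys
parts-above-one k Vec.[] Vecᴬ.[] = [] , [] , z≤n , refl
parts-above-one k (x Vec.∷ xs) (1≤x Vecᴬ.∷ xs≥1) with parts-above-one k xs xs≥1
parts-above-one {suc j} k (suc zero Vec.∷ xs) _ | ys , ys≥2 , L≤j , eq =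
  ys , ys≥2 , m≤n⇒m≤1+n L≤j , (begin
    powerSum k ys + suc j    ≡⟨ +-suc (powerSum k ys) j ⟩
    suc (powerSum k ys + j)  ≡⟨ cong suc eq ⟩
    1 + rest + length ys     ≡⟨ cong (λ u → u + rest + length ys) (sym (^-zeroˡ k)) ⟩
    1 ^ k + rest + length ys ∎)
  where
  open ≡-Reasoning
  rest = Vec.sum (Vec.map (_^ k) xs)
parts-above-one {suc j} k (suc (suc x) Vec.∷ xs) _ | ys , ys≥2 , L≤j , eq =
  suc (suc x) ∷ ys , s≤s (s≤s z≤n) ∷ ys≥2 , s≤s L≤j ,
    trans (shift _ _ j) (trans (cong (λ u → suc (suc x) ^ k + suc u) eq) (sym (shift _ _ (length ys))))
  where
  shift : ∀ a u v → a + u + suc v ≡ a + suc (u + v)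
  shift = solve-∀
parts-above-one k (zero Vec.∷ xs) (() Vecᴬ.∷ _) | _

representable⇒excess : ∀ {j k m} → Representable j k (m + j) → ExcessRepresentable j k m
representable⇒excess {j} {k} {m} (xs , xs≥1 , sum≡) with parts-above-one k xs xs≥1
... | ys , ys≥2 , L≤j , eq = ys , ys≥2 , L≤j , +-cancelʳ-≡ j _ _ (begin
  powerSum k ys + j                       ≡⟨ eq ⟩
  Vec.sum (Vec.map (_^ k) xs) + length ys ≡⟨ cong (_+ length ys) sum≡ ⟩
  m + j + length ys                       ≡⟨ +-right-comm m j (length ys) ⟩
  m + length ys + j                       ∎)
  where
  open ≡-Reasoning
  +-right-comm : ∀ a b c → a + b + c ≡ a + c + b
  +-right-comm = solve-∀

ones : ∀ k r → Σ (Vec ℕ r) λ xs → Vecᴬ.All (1 ≤_) xs × Vec.sum (Vec.map (_^ k) xs) ≡ r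
ones k zero = Vec.[] , Vecᴬ.[] , refl
ones k (suc r) with ones k r
... | xs , xs≥1 , eq = 1 Vec.∷ xs , s≤s z≤n Vecᴬ.∷ xs≥1 , cong₂ _+_ (^-zeroˡ k) eq

pad-with-ones : ∀ k ys r → All (1 ≤_) ys →
  Σ (Vec ℕ (length ys + r)) λ xs → Vecᴬ.All (1 ≤_) xs × Vec.sum (Vec.map (_^ k) xs) ≡ powerSum k ys + r
pad-with-ones k [] r [] = ones k r
pad-with-ones k (y ∷ ys) r (1≤y ∷ ys≥1) with pad-with-ones k ys r ys≥1
... | xs , xs≥1 , eq =
  y Vec.∷ xs , 1≤y Vecᴬ.∷ xs≥1 , trans (cong (y ^ k +_) eq) (sym (+-assoc (y ^ k) (powerSum k ys) r))

excess⇒representable : ∀ {j k m} → ExcessRepresentable j k m → Representable j k (m + j)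
excess⇒representable {k = k} {m} (ys , ys≥2 , L≤j , eq) with m≤n⇒∃[o]m+o≡n L≤j
... | r , refl with pad-with-ones k ys r (All.map (≤-trans (s≤s z≤n)) ys≥2)
... | xs , xs≥1 , sum≡ = xs , xs≥1 , (begin
  Vec.sum (Vec.map (_^ k) xs) ≡⟨ sum≡ ⟩
  powerSum k ys + r           ≡⟨ cong (_+ r) eq ⟩
  m + length ys + r           ≡⟨ +-assoc m (length ys) r ⟩
  m + (length ys + r)         ∎)
  where open ≡-Reasoning

length*≤powerSum : ∀ {a} k ys → All (a ≤_) ys → length ys * a ^ k ≤ powerSum k ys
length*≤powerSum k [] [] = z≤n
length*≤powerSum k (y ∷ ys) (a≤y ∷ ys≥a) = +-mono-≤ (^-monoˡ-≤ k a≤y) (length*≤powerSum k ys ys≥a)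

length≤powerSum : ∀ k ys → All (1 ≤_) ys → length ys ≤ powerSum k ys
length≤powerSum k [] [] = z≤n
length≤powerSum k (y ∷ ys) (1≤y ∷ ys≥1) =
  +-mono-≤ (m^n>0 y ⦃ >-nonZero 1≤y ⦄ k) (length≤powerSum k ys ys≥1)

large-part-bound : ∀ {b} k ys → All (1 ≤_) ys → Any (b ≤_) ys → b ^ k + length ys ≤ suc (powerSum k ys)
large-part-bound {b} k (y ∷ ys) (_ ∷ ys≥1) (here b≤y) = begin
  b ^ k + suc (length ys)  ≡⟨ +-suc (b ^ k) (length ys) ⟩
  suc (b ^ k + length ys)  ≤⟨ s≤s (+-mono-≤ (^-monoˡ-≤ k b≤y) (length≤powerSum k ys ys≥1)) ⟩
  suc (y ^ k + powerSum k ys) ∎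
  where open ≤-Reasoning
large-part-bound {b} k (y ∷ ys) (1≤y ∷ ys≥1) (there big) = begin
  b ^ k + suc (length ys)  ≡⟨ +-suc (b ^ k) (length ys) ⟩
  suc (b ^ k + length ys)  ≤⟨ s≤s (large-part-bound k ys ys≥1 big) ⟩
  1 + suc (powerSum k ys)  ≡⟨ sym (+-suc 1 (powerSum k ys)) ⟩
  suc (1 + powerSum k ys)  ≤⟨ s≤s (+-monoˡ-≤ (powerSum k ys) (m^n>0 y ⦃ >-nonZero 1≤y ⦄ k)) ⟩
  suc (y ^ k + powerSum k ys) ∎
  where open ≤-Reasoning

part≥4⊎twos-and-threes : ∀ k ys → All (2 ≤_) ys →
  Any (4 ≤_) ys ⊎ Σ ℕ λ e → Σ ℕ λ δ → length ys ≡ e + δ × powerSum k ys ≡ e * 2 ^ k + δ * 3 ^ k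
part≥4⊎twos-and-threes k [] [] = inj₂ (0 , 0 , refl , refl)
part≥4⊎twos-and-threes k (y ∷ ys) (_ ∷ ys≥2) with part≥4⊎twos-and-threes k ys ys≥2
part≥4⊎twos-and-threes k (suc (suc (suc (suc y))) ∷ ys) _ | _ = inj₁ (here (s≤s (s≤s (s≤s (s≤s z≤n)))))
... | inj₁ big = inj₁ (there big)
part≥4⊎twos-and-threes k (2 ∷ ys) _ | inj₂ (e , δ , L≡ , P≡) =
  inj₂ (suc e , δ , cong suc L≡ , trans (cong (2 ^ k +_) P≡) (sym (+-assoc (2 ^ k) (e * 2 ^ k) (δ * 3 ^ k))))
part≥4⊎twos-and-threes k (3 ∷ ys) _ | inj₂ (e , δ , L≡ , P≡) =
  inj₂ (e , suc δ , trans (cong suc L≡) (sym (+-suc e δ)) ,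
        trans (cong (3 ^ k +_) P≡) (+-left-comm (3 ^ k) (e * 2 ^ k) (δ * 3 ^ k)))
  where
  +-left-comm : ∀ a b c → a + (b + c) ≡ b + (a + c)
  +-left-comm = solve-∀
part≥4⊎twos-and-threes k (0 ∷ ys) (() ∷ _) | inj₂ _
part≥4⊎twos-and-threes k (1 ∷ ys) (s≤s () ∷ _) | inj₂ _

powerSum-replicate : ∀ k e y → powerSum k (replicate e y) ≡ e * y ^ k
powerSum-replicate k zero y = refl
powerSum-replicate k (suc e) y = cong (y ^ k +_) (powerSum-replicate k e y)

excess-of-twos-and-threes : ∀ c d e δ m →
  e * suc c + δ * (suc c + d) ≡ m + (e + δ) → (e + δ) * c + δ * d ≡ m
excess-of-twos-and-threes c d e δ m eq = +-cancelʳ-≡ (e + δ) _ m (trans (regroup c d e δ) eq)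
  where
  regroup : ∀ c d e δ → (e + δ) * c + δ * d + (e + δ) ≡ e * (1 + c) + δ * ((1 + c) + d)
  regroup = solve-∀

below-square : ∀ {c j r} → j + 1 ≤ suc c → r < c → suc ((j + 1) * c + r) < suc c * suc c
below-square {c} {j} {r} j+1≤ r<c = begin-strict
  suc ((j + 1) * c + r) ≡⟨ sym (+-suc ((j + 1) * c) r) ⟩
  (j + 1) * c + suc r   ≤⟨ +-mono-≤ (*-monoˡ-≤ c j+1≤) r<c ⟩
  suc c * c + c         <⟨ +-monoʳ-< (suc c * c) (n<1+n c) ⟩
  suc c * c + suc c     ≡⟨ trans (+-comm (suc c * c) (suc c)) (sym (*-suc (suc c) c)) ⟩
  suc c * suc c         ∎
  where open ≤-Reasoning

threes-bound : ∀ {h d e δ j i} → (e + δ) * (3 + h) + δ * d ≡ (j + 1) * (3 + h) + suc i →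
  5 ≤ d → j + 1 ≤ 4 + h → i ≤ suc h → δ ≤ suc h
threes-bound {h} {d} {e} {δ} {j} {i} eq 5≤d j+1≤ i≤ = ≮⇒≥ λ 1+h<δ →
  m+1+n≰m _ (subst (_≤ (4 + h) * (3 + h) + (2 + h)) (overshoot h) (begin
  (2 + h) * ((3 + h) + 5)        ≤⟨ *-mono-≤ 1+h<δ (+-monoʳ-≤ (3 + h) 5≤d) ⟩
  δ * ((3 + h) + d)              ≡⟨ *-distribˡ-+ δ (3 + h) d ⟩
  δ * (3 + h) + δ * d            ≤⟨ +-monoˡ-≤ (δ * d) (*-monoˡ-≤ (3 + h) (m≤n+m δ e)) ⟩
  (e + δ) * (3 + h) + δ * d      ≡⟨ eq ⟩
  (j + 1) * (3 + h) + suc i      ≤⟨ +-mono-≤ (*-monoˡ-≤ (3 + h) j+1≤) (s≤s i≤) ⟩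
  (4 + h) * (3 + h) + (2 + h)    ∎))
  where
  open ≤-Reasoning
  overshoot : ∀ h → (2 + h) * ((3 + h) + 5) ≡ (4 + h) * (3 + h) + (2 + h) + (1 + (1 + 2 * h))
  overshoot = solve-∀

-- suc δ is the number of threes in any representation of the excess (j+1)c + (i+1), c = 2^k − 1 = 3 + h.
threes-residue : ∀ {j k h d i} → 2 ^ k ≡ 4 + h → 3 ^ k ≡ (4 + h) + d → 5 ≤ d →
  j + 1 ≤ 4 + h → i ≤ suc h →
  ExcessRepresentable j k ((j + 1) * (3 + h) + suc i) →
  Σ ℕ λ δ → δ ≤ h × (suc δ * d) % (3 + h) ≡ suc i
threes-residue {j} {k} {h} {d} {i} 2^k≡ 3^k≡ 5≤d j+1≤ i≤ (ys , ys≥2 , _ , P≡)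
  with part≥4⊎twos-and-threes k ys ys≥2
... | inj₁ big = ⊥-elim (<⇒≱ (below-square j+1≤ (s≤s (s≤s i≤))) (begin
  (4 + h) * (4 + h) ≡⟨ cong (λ a → a * a) (sym 2^k≡) ⟩
  2 ^ k * 2 ^ k     ≡⟨ sym (^-distribʳ-* 2 2 k) ⟩
  4 ^ k             ≤⟨ +-cancelʳ-≤ (length ys) _ _ (begin
    4 ^ k + length ys          ≤⟨ large-part-bound k ys (All.map (≤-trans (s≤s z≤n)) ys≥2) big ⟩
    suc (powerSum k ys)        ≡⟨ cong suc P≡ ⟩
    suc (m + length ys)        ∎) ⟩
  suc m             ∎))
  where
  open ≤-Reasoning
  m = (j + 1) * (3 + h) + suc i
... | inj₂ (e , δ , L≡ , P≡₂₃) = positive δ (threes-bound {e = e} R 5≤d j+1≤ i≤) residue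
  where
  m = (j + 1) * (3 + h) + suc i
  R : (e + δ) * (3 + h) + δ * d ≡ m
  R = excess-of-twos-and-threes (3 + h) d e δ m (begin
    e * (4 + h) + δ * ((4 + h) + d) ≡⟨ cong₂ (λ a b → e * a + δ * b) (sym 2^k≡) (sym 3^k≡) ⟩
    e * 2 ^ k + δ * 3 ^ k           ≡⟨ sym P≡₂₃ ⟩
    powerSum k ys                   ≡⟨ P≡ ⟩
    m + length ys                   ≡⟨ cong (m +_) L≡ ⟩
    m + (e + δ)                     ∎)
    where open ≡-Reasoning
  residue : (δ * d) % (3 + h) ≡ suc i
  residue = remainder-unique (e + δ) (δ * d) (j + 1) (suc i) R (s≤s (s≤s i≤))
  positive : ∀ δ′ → δ′ ≤ suc h → (δ′ * d) % (3 + h) ≡ suc i →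
    Σ ℕ λ δ → δ ≤ h × (suc δ * d) % (3 + h) ≡ suc i
  positive zero _ ()
  positive (suc δ′) (s≤s δ′≤h) r = δ′ , δ′≤h , r

no-run-of-excesses : ∀ {j k h} → 2 ≤ k → 2 ^ k ≡ 4 + h → j + 1 ≤ 4 + h →
  ¬ (∀ (i : Fin (2 + h)) → ExcessRepresentable j k ((j + 1) * (3 + h) + suc (toℕ i)))
no-run-of-excesses {j} {k} {h} 2≤k 2^k≡ j+1≤ reps with m≤n⇒∃[o]m+o≡n (2^k+5≤3^k 2≤k)
... | o , 2^k+5+o≡3^k = collision (pigeonhole ≤-refl threes)
  where
  d = 5 + o
  3^k≡ : 3 ^ k ≡ (4 + h) + d
  3^k≡ = trans (sym 2^k+5+o≡3^k) (trans (+-assoc (2 ^ k) 5 o) (cong (_+ d) 2^k≡))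
  count : (i : Fin (2 + h)) → Σ ℕ λ δ → δ ≤ h × (suc δ * d) % (3 + h) ≡ suc (toℕ i)
  count i = threes-residue {k = k} 2^k≡ 3^k≡ (m≤m+n 5 o) j+1≤ (toℕ≤pred[n] i) (reps i)
  count< : (i : Fin (2 + h)) → proj₁ (count i) < suc h
  count< i = s≤s (proj₁ (proj₂ (count i)))
  threes : Fin (2 + h) → Fin (1 + h)
  threes i = fromℕ< (count< i)
  collision : (Σ (Fin (2 + h)) λ x → Σ (Fin (2 + h)) λ y → toℕ x < toℕ y × threes x ≡ threes y) → ⊥
  collision (x , y , x<y , same) = <-irrefl (suc-injective (begin
    suc (toℕ x)                           ≡⟨ sym (proj₂ (proj₂ (count x))) ⟩
    (suc (proj₁ (count x)) * d) % (3 + h) ≡⟨ cong (λ δ → (suc δ * d) % (3 + h)) same-count ⟩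
    (suc (proj₁ (count y)) * d) % (3 + h) ≡⟨ proj₂ (proj₂ (count y)) ⟩
    suc (toℕ y)                           ∎)) x<y
    where
    open ≡-Reasoning
    same-count : proj₁ (count x) ≡ proj₁ (count y)
    same-count = trans (sym (toℕ-fromℕ< (count< x))) (trans (cong toℕ same) (toℕ-fromℕ< (count< y)))

critical-excess-large-j : ∀ {j k c} → suc c ≡ 2 ^ k → suc c ≤ j → ExcessRepresentable j k ((j + 1) * c)
critical-excess-large-j {k = k} {c} 2^k≡ c<j with m≤n⇒∃[o]m+o≡n c<j
... | e , refl = 4 ∷ replicate e 2 , s≤s (s≤s z≤n) ∷ replicate⁺ e ≤-refl ,
  s≤s (≤-trans (≤-reflexive (length-replicate e)) (m≤n+m e c)) , (begin
  4 ^ k + powerSum k (replicate e 2)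
    ≡⟨ cong₂ _+_ (^-distribʳ-* 2 2 k) (powerSum-replicate k e 2) ⟩
  2 ^ k * 2 ^ k + e * 2 ^ k
    ≡⟨ cong (λ a → a * a + e * a) (sym 2^k≡) ⟩
  suc c * suc c + e * suc c
    ≡⟨ expand c e ⟩
  (suc c + e + 1) * c + suc e
    ≡⟨ cong (λ l → (suc c + e + 1) * c + suc l) (sym (length-replicate e)) ⟩
  (suc c + e + 1) * c + suc (length (replicate e 2)) ∎)
  where
  open ≡-Reasoning
  expand : ∀ c e → (1 + c) * (1 + c) + e * (1 + c) ≡ (1 + c + e + 1) * c + (1 + e)
  expand = solve-∀

critical-excess-small-j : ∀ {j k c} → 1 ≤ j → 1 ≤ k → suc c ≡ 2 ^ k → j < suc c →
  (∀ i → ¬ ¬ ExcessRepresentable j k ((j + 1) * c + suc i)) → ExcessRepresentable j k ((j + 1) * c)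
critical-excess-small-j {1} {1} _ _ refl _ _ = 3 ∷ [] , s≤s (s≤s z≤n) ∷ [] , ≤-refl , refl
critical-excess-small-j {suc (suc _)} {1} _ _ refl (s≤s (s≤s ())) _
critical-excess-small-j {j} {suc (suc k)} {c} _ _ 2^k≡ j<c larger
  with m≤n⇒∃[o]m+o≡n (^-monoʳ-≤ 2 {2} {suc (suc k)} (s≤s (s≤s z≤n)))
... | h , 4+h≡2^k with suc-injective (trans 2^k≡ (sym 4+h≡2^k))
... | refl = ⊥-elim (¬¬-∀-Fin (larger ∘ toℕ)
  (no-run-of-excesses {k = suc (suc k)} (s≤s (s≤s z≤n)) (sym 4+h≡2^k) (subst (_≤ 4 + h) (+-comm 1 j) j<c)))

critical-excess : ∀ {j k c} → 1 ≤ j → 1 ≤ k → suc c ≡ 2 ^ k →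
  (∀ i → ¬ ¬ ExcessRepresentable j k ((j + 1) * c + suc i)) → ExcessRepresentable j k ((j + 1) * c)
critical-excess {j} {k} {c} 1≤j 1≤k 2^k≡ larger with suc c ≤? j
... | yes c<j = critical-excess-large-j {k = k} 2^k≡ c<j
... | no c≮j = critical-excess-small-j 1≤j 1≤k 2^k≡ (≰⇒> c≮j) larger

many-parts-lower-bound : ∀ {j k c m ys} → suc c ≡ 2 ^ k →
  All (2 ≤_) ys → powerSum k ys ≡ m + length ys → j < length ys → (j + 1) * c ≤ m
many-parts-lower-bound {j} {k} {c} {m} {ys} 2^k≡ ys≥2 P≡ j<L = begin
  (j + 1) * c   ≤⟨ *-monoˡ-≤ c (subst (_≤ length ys) (+-comm 1 j) j<L) ⟩
  length ys * c ≤⟨ +-cancelˡ-≤ (length ys) _ _ (begin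
    length ys + length ys * c ≡⟨ sym (*-suc (length ys) c) ⟩
    length ys * suc c         ≡⟨ cong (length ys *_) 2^k≡ ⟩
    length ys * 2 ^ k         ≤⟨ length*≤powerSum k ys ys≥2 ⟩
    powerSum k ys             ≡⟨ trans P≡ (+-comm m (length ys)) ⟩
    length ys + m             ∎) ⟩
  m             ∎
  where open ≤-Reasoning

below-threshold : ∀ {m j c} → m + j < suc c * (j + 1) → m ≤ (j + 1) * c
below-threshold {m} {j} {c} m+j< = subst (m ≤_) (*-comm c (j + 1))
  (+-cancelˡ-≤ (j + 1) _ _ (subst (_≤ suc c * (j + 1)) (reorder m j) m+j<))
  where
  reorder : ∀ m j → suc (m + j) ≡ (j + 1) + m
  reorder = solve-∀

above-threshold : ∀ {c j i} → suc c * (j + 1) ≤ (j + 1) * c + suc i + j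
above-threshold {c} {j} {i} = subst (suc c * (j + 1) ≤_) (sym (reorder c j i)) (m≤m+n _ i)
  where
  reorder : ∀ c j i → (j + 1) * c + (1 + i) + j ≡ (1 + c) * (j + 1) + i
  reorder = solve-∀

lemma10p15 : (j k : ℕ) → 1 ≤ j → 1 ≤ k → FiniteSet (B j k) →
    (M : ℕ) → IsMax (B j k) M → M < 2 ^ k * (j + 1) →
    ∀ m → ¬ Bbar j k m
lemma10p15 j k 1≤j 1≤k _ M (_ , M-max) M<Q m ((1≤m , m+j∈B) , m∉Bᵏ) with m≤n⇒∃[o]m+o≡n (m^n>0 2 k)
... | c , 2^k≡ = m∉Bᵏ λ j′ _ →
  1≤m , ≤-trans 1≤m (m≤m+n m j′) , not-excess-representable j′ ∘ representable⇒excess {k = k}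
  where
  m+j∉R = proj₂ m+j∈B
  beyond-max : ∀ n → 2 ^ k * (j + 1) ≤ n → ¬ ¬ Representable j k n
  beyond-max n Q≤n n∉R = <⇒≱ M<n (M-max n (≤-trans (s≤s z≤n) M<n , n∉R))
    where M<n = <-≤-trans M<Q Q≤n
  larger : ∀ i → ¬ ¬ ExcessRepresentable j k ((j + 1) * c + suc i)
  larger i ¬rep = beyond-max _ (subst (λ a → a * (j + 1) ≤ _) 2^k≡ (above-threshold {c} {j} {i}))
    (¬rep ∘ representable⇒excess {k = k})
  not-excess-representable : ∀ j′ → ¬ ExcessRepresentable j′ k m
  not-excess-representable j′ (ys , ys≥2 , _ , P≡) with length ys ≤? j
  ... | yes L≤j = m+j∉R (excess⇒representable {k = k} (ys , ys≥2 , L≤j , P≡))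
  ... | no L≰j = m+j∉R (subst (λ x → Representable j k (x + j)) critical
                  (excess⇒representable {k = k} (critical-excess 1≤j 1≤k 2^k≡ larger)))
    where
    critical : (j + 1) * c ≡ m
    critical = ≤-antisym (many-parts-lower-bound {k = k} 2^k≡ ys≥2 P≡ (≰⇒> L≰j))
      (below-threshold (subst (λ a → m + j < a * (j + 1)) (sym 2^k≡) (≤-<-trans (M-max (m + j) m+j∈B) M<Q)))
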